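{- Let $n\ge 1$ and let $a_i,b_i,c_i,d_i\in\mathbb{R}$ $(1\le i\le n)$ and $p_i,q_i\in\mathbb{R}$ $(1\le i\le n-1)$. Put $A_i=\begin{bmatrix} a_i & b_i\\ c_i & d_i\end{bmatrix}$, $J_2=\begin{bmatrix}1&1\\1&1\end{bmatrix}$, $O_2$ the $2\times2$ zero matrix, and let $T_n\in\mathbb{R}^{2n\times 2n}$ be the block tridiagonal matrix with diagonal blocks $A_1,\dots,A_n$, superdiagonal blocks $p_1J_2,\dots,p_{n-1}J_2$, subdiagonal blocks $q_1J_2,\dots,q_{n-1}J_2$, and all other blocks equal to $O_2$. Suppose each $A_i$ is nonsingular, and let $g_k=\det T_k$ (where $T_k$ is built from the first $k$ blocks). Setting $t_i=a_i+d_i-b_i-c_i$, we have \[g_1=a_1d_1-b_1c_1,\qquad g_2=\det A_1\,\det A_2-p_1q_1t_1t_2,\] and for $n\ge 3$, \[g_n=\det A_n\; g_{n-1}-p_{n-1}\,q_{n-1}\,t_n\,t_{n-1}\,g_{n-2}.\] -}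

module Defs where

open import Level using (Level)
open import Algebra.Bundles using (CommutativeRing)
open import Data.Nat using (ℕ; zero; suc; _≟_)
open import Data.Fin using (Fin; zero; suc; toℕ; punchIn; quotRem)
open import Data.Product using (∃; proj₁; proj₂)
open import Relation.Nullary using (yes; no)

module _ {ℓ₁ ℓ₂ : Level} (R : CommutativeRing ℓ₁ ℓ₂) where
  open CommutativeRing R using (Carrier; _≈_; _+_; _*_; -_; 0#; 1#)

  Matrix : ℕ → Set ℓ₁
  Matrix m = Fin m → Fin m → Carrier

  sumF : ∀ {m} → (Fin m → Carrier) → Carrier
  sumF {zero}  f = 0#
  sumF {suc m} f = f zero + sumF (λ j → f (suc j))

  sgn : ℕ → Carrier
  sgn zero    = 1#
  sgn (suc k) = - sgn k

  det : ∀ m → Matrix m → Carrier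
  det zero    M = 1#
  det (suc m) M =
    sumF (λ j → (sgn (toℕ j) * M zero j) * det m (λ r s → M (suc r) (punchIn j s)))

  IsUnit : Carrier → Set (ℓ₁ Level.⊔ ℓ₂)
  IsUnit x = ∃ λ y → x * y ≈ 1#

  -- parameters: sequences indexed 1-based (index 0 unused)
  module Tridiag (a b c d p q : ℕ → Carrier) where

    A : ℕ → Matrix 2
    A i zero       zero       = a i
    A i zero       (suc zero) = b i
    A i (suc zero) zero       = c i
    A i (suc zero) (suc zero) = d i

    t : ℕ → Carrier
    t i = ((a i + d i) + - b i) + - c i

    -- block (I, J) of T_k at 0-based block indices I, J, entry (u, v)
    block : ℕ → ℕ → Fin 2 → Fin 2 → Carrier
    block I J u v with I ≟ J | suc I ≟ J | I ≟ suc J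
    ... | yes _ | _     | _     = A (suc I) u v
    ... | no _  | yes _ | _     = p (suc I)
    ... | no _  | no _  | yes _ = q (suc J)
    ... | no _  | no _  | no _  = 0#

    -- T_k : (2k)×(2k), row index r = 2·(block index) + (inner index)
    T : ∀ k → Matrix (k Data.Nat.* 2)
    T k r s = block (toℕ (proj₂ (quotRem {k} 2 r))) (toℕ (proj₂ (quotRem {k} 2 s)))
                    (proj₁ (quotRem {k} 2 r)) (proj₁ (quotRem {k} 2 s))

    g : ℕ → Carrier
    g k = det (k Data.Nat.* 2) (T k)

{-# OPTIONS --safe #-}
module Submission where

open import Defs
open import Level using (Level)
open import Algebra.Bundles using (CommutativeRing)
open import Data.Nat using (ℕ; _≤_)
open import Data.Product using (_×_)

open import Algebra.Solver.Ring.AlmostCommutativeRing using (fromCommutativeRing; _-Raw-AlmostCommutative⟶_)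
open import Data.Empty using (⊥-elim)
open import Data.Fin using (Fin; zero; suc; #_; toℕ; punchIn; quotRem)
open import Data.Integer as ℤ using (ℤ; +_; -[1+_]; _⊖_)
import Data.Integer.Properties as ℤ
open import Data.Maybe using (Maybe; just; nothing)
open import Data.Nat as ℕ using (zero; suc; s≤s)
import Data.Nat.Properties as ℕ
open import Data.Product using (_,_; proj₁; proj₂)
open import Function using (_∘_)
open import Relation.Nullary using (yes; no)
open import Relation.Binary.PropositionalEquality as ≡ using (_≡_; _≢_)

-- Write T_{k+1} as A₁ bordered by p₁J₂ and q₁J₂ around the block tridiagonal matrix T′_k of
-- A₂, A₃, …. Below its first two rows, the first two columns of T_{k+2} coincide, both being
-- (q₁, q₁, 0, …). Expanding along the first two rows, every surviving minor is either
-- det T′_{k+1} or has that column in front, and then equals q₁ times a 2 × 2 difference of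
-- entries of A₂ times det T″_k. Collecting terms gives the recurrence from the top-left corner,
--   det T_{k+2} = det A₁ · det T′_{k+1} − p₁q₁t₁t₂ · det T″_k ,
-- so g_k is the continuant of the sequences det Aᵢ and pᵢqᵢtᵢtᵢ₊₁. A continuant obeys the
-- same three-term recurrence read from its other end, which is the claimed recurrence.

-- Algebra.Solver.Ring needs a coefficient ring with decidable equality mapped into the
-- carrier; for an arbitrary commutative ring that is ℤ.
module IntegerCoefficients {ℓ₁ ℓ₂ : Level} (R : CommutativeRing ℓ₁ ℓ₂) where
  open CommutativeRing R
  open import Algebra.Properties.Ring ring
    using (-0#≈0#; -‿involutive; -‿distribˡ-*; -‿distribʳ-*; -‿+-comm)
  open import Algebra.Properties.CommutativeSemigroup +-commutativeSemigroup using (interchange)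
  open import Algebra.Properties.Semiring.Mult.TCOptimised semiring
    using (1+×; ×-homo-+; ×1-homo-*) renaming (_×_ to _×ₙ_)
  open import Relation.Binary.Reasoning.Setoid setoid

  ⟦_⟧ : ℤ → Carrier
  ⟦ + n ⟧     = n ×ₙ 1#
  ⟦ -[1+ n ] ⟧ = - (suc n ×ₙ 1#)

  -‿homo : ∀ i → ⟦ ℤ.- i ⟧ ≈ - ⟦ i ⟧
  -‿homo (+ 0)     = sym -0#≈0#
  -‿homo (+ suc n) = refl
  -‿homo -[1+ n ]  = sym (-‿involutive _)

  ⊖-homo : ∀ m n → ⟦ m ⊖ n ⟧ ≈ m ×ₙ 1# - n ×ₙ 1#
  ⊖-homo 0       0       = sym (trans (+-identityˡ _) -0#≈0#)
  ⊖-homo 0       (suc n) = sym (+-identityˡ _)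
  ⊖-homo (suc m) 0       = sym (trans (+-congˡ -0#≈0#) (+-identityʳ _))
  ⊖-homo (suc m) (suc n) = begin
    ⟦ suc m ⊖ suc n ⟧                  ≡⟨ ≡.cong ⟦_⟧ (ℤ.[1+m]⊖[1+n]≡m⊖n m n) ⟩
    ⟦ m ⊖ n ⟧                          ≈⟨ ⊖-homo m n ⟩
    m ×ₙ 1# - n ×ₙ 1#                  ≈⟨ +-identityˡ _ ⟨
    0# + (m ×ₙ 1# - n ×ₙ 1#)           ≈⟨ +-congʳ (-‿inverseʳ 1#) ⟨
    (1# - 1#) + (m ×ₙ 1# - n ×ₙ 1#)    ≈⟨ interchange 1# (- 1#) (m ×ₙ 1#) (- (n ×ₙ 1#)) ⟩
    (1# + m ×ₙ 1#) + (- 1# - n ×ₙ 1#)  ≈⟨ +-congˡ (-‿+-comm 1# (n ×ₙ 1#)) ⟩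
    (1# + m ×ₙ 1#) - (1# + n ×ₙ 1#)    ≈⟨ +-cong (1+× m 1#) (-‿cong (1+× n 1#)) ⟨
    suc m ×ₙ 1# - suc n ×ₙ 1#          ∎

  +-homo : ∀ i j → ⟦ i ℤ.+ j ⟧ ≈ ⟦ i ⟧ + ⟦ j ⟧
  +-homo (+ m)    (+ n)    = ×-homo-+ 1# m n
  +-homo (+ m)    -[1+ n ] = ⊖-homo m (suc n)
  +-homo -[1+ m ] (+ n)    = trans (⊖-homo n (suc m)) (+-comm _ _)
  +-homo -[1+ m ] -[1+ n ] = begin
    - (suc (suc (m ℕ.+ n)) ×ₙ 1#)    ≡⟨ ≡.cong (λ k → - (suc k ×ₙ 1#)) (ℕ.+-suc m n) ⟨
    - ((suc m ℕ.+ suc n) ×ₙ 1#)      ≈⟨ -‿cong (×-homo-+ 1# (suc m) (suc n)) ⟩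
    - (suc m ×ₙ 1# + suc n ×ₙ 1#)    ≈⟨ -‿+-comm _ _ ⟨
    - (suc m ×ₙ 1#) - suc n ×ₙ 1#    ∎

  pos-*-homo : ∀ m j → ⟦ + m ℤ.* j ⟧ ≈ ⟦ + m ⟧ * ⟦ j ⟧
  pos-*-homo m (+ n) = begin
    ⟦ + m ℤ.* + n ⟧    ≡⟨ ≡.cong ⟦_⟧ (ℤ.pos-* m n) ⟨
    (m ℕ.* n) ×ₙ 1#    ≈⟨ ×1-homo-* m n ⟩
    ⟦ + m ⟧ * ⟦ + n ⟧  ∎
  pos-*-homo m -[1+ n ] = begin
    ⟦ + m ℤ.* ℤ.- + suc n ⟧    ≡⟨ ≡.cong ⟦_⟧ (ℤ.neg-distribʳ-* (+ m) (+ suc n)) ⟨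
    ⟦ ℤ.- (+ m ℤ.* + suc n) ⟧  ≈⟨ -‿homo (+ m ℤ.* + suc n) ⟩
    - ⟦ + m ℤ.* + suc n ⟧      ≈⟨ -‿cong (pos-*-homo m (+ suc n)) ⟩
    - (⟦ + m ⟧ * ⟦ + suc n ⟧)  ≈⟨ -‿distribʳ-* _ _ ⟩
    ⟦ + m ⟧ * ⟦ -[1+ n ] ⟧     ∎

  *-homo : ∀ i j → ⟦ i ℤ.* j ⟧ ≈ ⟦ i ⟧ * ⟦ j ⟧
  *-homo (+ m)    j = pos-*-homo m j
  *-homo -[1+ m ] j = begin
    ⟦ ℤ.- + suc m ℤ.* j ⟧    ≡⟨ ≡.cong ⟦_⟧ (ℤ.neg-distribˡ-* (+ suc m) j) ⟨
    ⟦ ℤ.- (+ suc m ℤ.* j) ⟧  ≈⟨ -‿homo (+ suc m ℤ.* j) ⟩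
    - ⟦ + suc m ℤ.* j ⟧      ≈⟨ -‿cong (pos-*-homo (suc m) j) ⟩
    - (⟦ + suc m ⟧ * ⟦ j ⟧)  ≈⟨ -‿distribˡ-* _ _ ⟩
    ⟦ -[1+ m ] ⟧ * ⟦ j ⟧     ∎

  ℤ⟶R : ℤ.+-*-rawRing -Raw-AlmostCommutative⟶ fromCommutativeRing R
  ℤ⟶R = record
    { ⟦_⟧ = ⟦_⟧ ; +-homo = +-homo ; *-homo = *-homo ; -‿homo = -‿homo
    ; 0-homo = refl ; 1-homo = refl }

  coefficient≟ : ∀ i j → Maybe (⟦ i ⟧ ≈ ⟦ j ⟧)
  coefficient≟ i j with i ℤ.≟ j
  ... | yes ≡.refl = just refl
  ... | no _       = nothing

  open import Algebra.Solver.Ring ℤ.+-*-rawRing (fromCommutativeRing R) ℤ⟶R coefficient≟ public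
    using (solve; _:=_; _:+_; _:-_; _:*_; :-_; con)

module Determinant {ℓ₁ ℓ₂ : Level} (R : CommutativeRing ℓ₁ ℓ₂) where
  open CommutativeRing R hiding (zero)
  open IntegerCoefficients R
  open import Algebra.Properties.Ring ring using (-‿distribˡ-*)
  open import Relation.Binary.Reasoning.Setoid setoid

  minor : ∀ {m} → Fin (suc m) → Fin (suc m) → Matrix R (suc m) → Matrix R m
  minor i j M r s = M (punchIn i r) (punchIn j s)

  expansionTerm : ∀ {m} → Matrix R (suc m) → Fin (suc m) → Carrier
  expansionTerm {m} M j = (sgn R (toℕ j) * M zero j) * det R m (minor zero j M)

  sumF-cong : ∀ {m} {f g : Fin m → Carrier} → (∀ j → f j ≈ g j) → sumF R f ≈ sumF R g
  sumF-cong {zero}  f≈g = refl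
  sumF-cong {suc m} f≈g = +-cong (f≈g zero) (sumF-cong (f≈g ∘ suc))

  sumF-zero : ∀ {m} (f : Fin m → Carrier) → (∀ j → f j ≈ 0#) → sumF R f ≈ 0#
  sumF-zero {zero}  f f≈0 = refl
  sumF-zero {suc m} f f≈0 =
    trans (+-cong (f≈0 zero) (sumF-zero (f ∘ suc) (f≈0 ∘ suc))) (+-identityʳ 0#)

  sumF-distribˡ : ∀ {m} x (f : Fin m → Carrier) → sumF R (λ j → x * f j) ≈ x * sumF R f
  sumF-distribˡ {zero}  x f = sym (zeroʳ x)
  sumF-distribˡ {suc m} x f =
    trans (+-congˡ (sumF-distribˡ x (f ∘ suc))) (sym (distribˡ x (f zero) (sumF R (f ∘ suc))))

  det-cong : ∀ m {M N : Matrix R m} → (∀ r s → M r s ≈ N r s) → det R m M ≈ det R m N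
  det-cong zero    M≈N = refl
  det-cong (suc m) {M} {N} M≈N = sumF-cong {f = expansionTerm M} {expansionTerm N} λ j →
    *-cong (*-congˡ (M≈N zero j)) (det-cong m λ r s → M≈N (suc r) (punchIn j s))

  expansionTerm-zero : ∀ {m} (M : Matrix R (suc m)) j → M zero j ≈ 0# → expansionTerm M j ≈ 0#
  expansionTerm-zero M j M₀ⱼ≈0 = trans (*-congʳ (trans (*-congˡ M₀ⱼ≈0) (zeroʳ _))) (zeroˡ _)

  det-zeroFirstColumn : ∀ {m} (M : Matrix R (suc m)) → (∀ r → M r zero ≈ 0#) →
    det R (suc m) M ≈ 0#
  det-zeroFirstColumn {zero}  M column≈0 =
    trans (+-congʳ (expansionTerm-zero M zero (column≈0 zero))) (+-identityʳ 0#)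
  det-zeroFirstColumn {suc m} M column≈0 = trans
    (+-cong (expansionTerm-zero M zero (column≈0 zero)) (sumF-zero (expansionTerm M ∘ suc) λ j →
      trans (*-congˡ (det-zeroFirstColumn (minor zero (suc j) M) (column≈0 ∘ suc))) (zeroʳ _)))
    (+-identityʳ 0#)

  det-firstColumnSupport₁ : ∀ {m} (M : Matrix R (suc m)) → (∀ r → M (suc r) zero ≈ 0#) →
    det R (suc m) M ≈ M (# 0) (# 0) * det R m (minor (# 0) (# 0) M)
  det-firstColumnSupport₁ {zero}  M _ = trans (+-identityʳ _) (*-congʳ (*-identityˡ _))
  det-firstColumnSupport₁ {suc m} M below≈0 = trans
    (+-cong (*-congʳ (*-identityˡ _)) (sumF-zero (expansionTerm M ∘ suc) λ j →
      trans (*-congˡ (det-zeroFirstColumn (minor zero (suc j) M) below≈0)) (zeroʳ _)))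
    (+-identityʳ _)

  det-firstColumnSupport₂ : ∀ {n} (M : Matrix R (suc (suc n))) →
    (∀ r → M (suc (suc r)) zero ≈ 0#) →
    det R (suc (suc n)) M ≈ M (# 0) (# 0) * det R (suc n) (minor (# 0) (# 0) M)
                            - M (# 1) (# 0) * det R (suc n) (minor (# 1) (# 0) M)
  det-firstColumnSupport₂ {n} M below≈0 = +-cong (*-congʳ (*-identityˡ _)) (begin
    sumF R (expansionTerm M ∘ suc)              ≈⟨ sumF-cong {f = expansionTerm M ∘ suc} term≈ ⟩
    sumF R (λ j → - M₁₀ * expansionTerm W j)    ≈⟨ sumF-distribˡ (- M₁₀) (expansionTerm W) ⟩
    - M₁₀ * det R (suc n) W                      ≈⟨ -‿distribˡ-* M₁₀ _ ⟨
    - (M₁₀ * det R (suc n) W)                    ∎)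
    where
    M₁₀ = M (# 1) (# 0)
    W = minor (# 1) (# 0) M
    term≈ : ∀ j → expansionTerm M (suc j) ≈ - M₁₀ * expansionTerm W j
    term≈ j = begin
      (- sgn R (toℕ j) * M zero (suc j)) * det R (suc n) (minor zero (suc j) M)
        ≈⟨ *-congˡ (det-firstColumnSupport₁ (minor zero (suc j) M) below≈0) ⟩
      (- sgn R (toℕ j) * M zero (suc j)) * (M₁₀ * det R n (minor zero j W))
        ≈⟨ solve 4 (λ σ x y e → (:- σ :* x) :* (y :* e) := :- y :* ((σ :* x) :* e))
             refl (sgn R (toℕ j)) (M zero (suc j)) M₁₀ _ ⟩
      - M₁₀ * expansionTerm W j ∎

  det-difference₀₀ : ∀ {n} (U V : Matrix R (suc n)) →
    (∀ s → U zero (suc s) ≈ V zero (suc s)) → (∀ r s → U (suc r) s ≈ V (suc r) s) →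
    det R (suc n) U - det R (suc n) V
      ≈ (U (# 0) (# 0) - V (# 0) (# 0)) * det R n (minor (# 0) (# 0) U)
  det-difference₀₀ {n} U V row₀≈ rows≈ = begin
    (expansionTerm U zero + rest) - (expansionTerm V zero + sumF R (expansionTerm V ∘ suc))
      ≈⟨ +-congˡ (-‿cong (+-cong (*-congˡ (det-cong n λ r s → sym (rows≈ r (suc s)))) rest≈)) ⟩
    ((1# * U (# 0) (# 0)) * D + rest) - ((1# * V (# 0) (# 0)) * D + rest)
      ≈⟨ solve 4 (λ u v d t → (con (+ 1) :* u) :* d :+ t :- ((con (+ 1) :* v) :* d :+ t)
                              := (u :- v) :* d)
           refl (U (# 0) (# 0)) (V (# 0) (# 0)) D rest ⟩
    (U (# 0) (# 0) - V (# 0) (# 0)) * D ∎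
    where
    D = det R n (minor (# 0) (# 0) U)
    rest = sumF R (expansionTerm U ∘ suc)
    rest≈ : sumF R (expansionTerm V ∘ suc) ≈ rest
    rest≈ = sumF-cong {f = expansionTerm V ∘ suc} {expansionTerm U ∘ suc} λ j →
      *-cong (*-congˡ (sym (row₀≈ j))) (det-cong n λ r s → sym (rows≈ r (punchIn (suc j) s)))

  det-doubledFirstColumn : ∀ {n} (M : Matrix R (suc (suc n))) →
    (∀ r → M (suc (suc r)) zero ≈ 0#) → M (# 0) (# 0) ≈ M (# 1) (# 0) →
    (∀ s → M (# 1) (suc (suc s)) ≈ M (# 0) (suc (suc s))) →
    det R (suc (suc n)) M ≈ M (# 1) (# 0) * ((M (# 1) (# 1) - M (# 0) (# 1))
                                            * det R n (λ r s → M (suc (suc r)) (suc (suc s))))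
  det-doubledFirstColumn {n} M below≈0 M₀₀≈M₁₀ row₁≈row₀ = begin
    det R (suc (suc n)) M
      ≈⟨ det-firstColumnSupport₂ M below≈0 ⟩
    M (# 0) (# 0) * det R (suc n) W₁ - M₁₀ * det R (suc n) W₀
      ≈⟨ +-congʳ (*-congʳ M₀₀≈M₁₀) ⟩
    M₁₀ * det R (suc n) W₁ - M₁₀ * det R (suc n) W₀
      ≈⟨ solve 3 (λ x u v → x :* u :- x :* v := x :* (u :- v)) refl M₁₀ _ _ ⟩
    M₁₀ * (det R (suc n) W₁ - det R (suc n) W₀)
      ≈⟨ *-congˡ (det-difference₀₀ W₁ W₀ row₁≈row₀ λ _ _ → refl) ⟩
    M₁₀ * ((M (# 1) (# 1) - M (# 0) (# 1)) * det R n (λ r s → M (suc (suc r)) (suc (suc s))))  ∎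
    where
    M₁₀ = M (# 1) (# 0)
    W₁ = minor (# 0) (# 0) M
    W₀ = minor (# 1) (# 0) M

  det-firstRowSupport₃ : ∀ {n} (M : Matrix R (3 ℕ.+ n)) {x₀ x₁ x₂} →
    (∀ s → M zero (suc (suc (suc s))) ≈ 0#) →
    det R (2 ℕ.+ n) (minor (# 0) (# 0) M) ≈ x₀ →
    det R (2 ℕ.+ n) (minor (# 0) (# 1) M) ≈ x₁ →
    det R (2 ℕ.+ n) (minor (# 0) (# 2) M) ≈ x₂ →
    det R (3 ℕ.+ n) M ≈ M (# 0) (# 0) * x₀ - M (# 0) (# 1) * x₁ + M (# 0) (# 2) * x₂
  det-firstRowSupport₃ M {x₀} {x₁} {x₂} row≈0 e₀ e₁ e₂ = trans
    (+-cong (*-congˡ e₀) (+-cong (*-congˡ e₁) (+-cong (*-congˡ e₂)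
      (sumF-zero (λ j → expansionTerm M (suc (suc (suc j))))
                 λ j → expansionTerm-zero M _ (row≈0 j)))))
    (solve 6 (λ a b c y₀ y₁ y₂ →
        (con (+ 1) :* a) :* y₀ :+ ((:- con (+ 1) :* b) :* y₁
          :+ ((:- :- con (+ 1) :* c) :* y₂ :+ con (+ 0)))
        := a :* y₀ :- b :* y₁ :+ c :* y₂)
      refl (M (# 0) (# 0)) (M (# 0) (# 1)) (M (# 0) (# 2)) x₀ x₁ x₂)

  det-firstRowSupport₄ : ∀ {n} (M : Matrix R (4 ℕ.+ n)) {x₀ x₁ x₂ x₃} →
    (∀ s → M zero (suc (suc (suc (suc s)))) ≈ 0#) →
    det R (3 ℕ.+ n) (minor (# 0) (# 0) M) ≈ x₀ →
    det R (3 ℕ.+ n) (minor (# 0) (# 1) M) ≈ x₁ →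
    det R (3 ℕ.+ n) (minor (# 0) (# 2) M) ≈ x₂ →
    det R (3 ℕ.+ n) (minor (# 0) (# 3) M) ≈ x₃ →
    det R (4 ℕ.+ n) M ≈ M (# 0) (# 0) * x₀ - M (# 0) (# 1) * x₁
                          + M (# 0) (# 2) * x₂ - M (# 0) (# 3) * x₃
  det-firstRowSupport₄ M {x₀} {x₁} {x₂} {x₃} row≈0 e₀ e₁ e₂ e₃ = trans
    (+-cong (*-congˡ e₀) (+-cong (*-congˡ e₁) (+-cong (*-congˡ e₂) (+-cong (*-congˡ e₃)
      (sumF-zero (λ j → expansionTerm M (suc (suc (suc (suc j)))))
                 λ j → expansionTerm-zero M _ (row≈0 j))))))
    (solve 8 (λ a b c d y₀ y₁ y₂ y₃ →
        (con (+ 1) :* a) :* y₀ :+ ((:- con (+ 1) :* b) :* y₁ :+ ((:- :- con (+ 1) :* c) :* y₂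
          :+ ((:- :- :- con (+ 1) :* d) :* y₃ :+ con (+ 0))))
        := a :* y₀ :- b :* y₁ :+ c :* y₂ :- d :* y₃)
      refl (M (# 0) (# 0)) (M (# 0) (# 1)) (M (# 0) (# 2)) (M (# 0) (# 3)) x₀ x₁ x₂ x₃)

  det₂ : (M : Matrix R 2) → det R 2 M ≈ M (# 0) (# 0) * M (# 1) (# 1) - M (# 0) (# 1) * M (# 1) (# 0)
  det₂ M = solve 4 (λ a b c d →
      (con (+ 1) :* a) :* ((con (+ 1) :* d) :* con (+ 1) :+ con (+ 0))
        :+ ((:- con (+ 1) :* b) :* ((con (+ 1) :* c) :* con (+ 1) :+ con (+ 0)) :+ con (+ 0))
      := a :* d :- b :* c)
    refl (M (# 0) (# 0)) (M (# 0) (# 1)) (M (# 1) (# 0)) (M (# 1) (# 1))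

module BlockTridiagonal {ℓ₁ ℓ₂ : Level} (R : CommutativeRing ℓ₁ ℓ₂) where
  open CommutativeRing R hiding (zero)
  open IntegerCoefficients R
  open Determinant R
  open import Relation.Binary.Reasoning.Setoid setoid

  headPair : ∀ {m} → Carrier → Fin m → Carrier
  headPair x zero          = x
  headPair x (suc zero)    = x
  headPair x (suc (suc _)) = 0#

  -- [ A     p E ]
  -- [ q Eᵀ  M   ]   where E = [ J₂ O ] is the 2 × m matrix with ones in its first two columns
  bordered : ∀ {m} → Matrix R 2 → Carrier → Carrier → Matrix R m → Matrix R (suc (suc m))
  bordered A p q M zero          zero          = A zero zero
  bordered A p q M zero          (suc zero)    = A zero (suc zero)
  bordered A p q M (suc zero)    zero          = A (suc zero) zero
  bordered A p q M (suc zero)    (suc zero)    = A (suc zero) (suc zero)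
  bordered A p q M zero          (suc (suc s)) = headPair p s
  bordered A p q M (suc zero)    (suc (suc s)) = headPair p s
  bordered A p q M (suc (suc r)) zero          = headPair q r
  bordered A p q M (suc (suc r)) (suc zero)    = headPair q r
  bordered A p q M (suc (suc r)) (suc (suc s)) = M r s

  -- uᵀ A u for u = (1, −1)ᵀ; the paper's tᵢ when A = Aᵢ
  τ : Matrix R 2 → Carrier
  τ A = ((A (# 0) (# 0) + A (# 1) (# 1)) - A (# 0) (# 1)) - A (# 1) (# 0)

  det-bordered₂ : ∀ {m} (A A′ : Matrix R 2) (p q p′ q′ : Carrier) (M : Matrix R m) →
    det R (4 ℕ.+ m) (bordered A p q (bordered A′ p′ q′ M))
      ≈ det R 2 A * det R (2 ℕ.+ m) (bordered A′ p′ q′ M) - (((p * q) * τ A) * τ A′) * det R m M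
  det-bordered₂ {m} A A′ p q p′ q′ M = begin
    det R (4 ℕ.+ m) N
      ≈⟨ det-firstRowSupport₄ N (λ _ → refl) minor₀ minor₁ minor₂ minor₃ ⟩
    a * (d * D′ - p * X₂ + p * X₃) - b * (c * D′ - p * X₂ + p * X₃)
      + p * (c * X₂ - d * X₂ + p * Z) - p * (c * X₃ - d * X₃ + p * Z)
      ≈⟨ solve 9 (λ a b c d p D′ X₂ X₃ Z →
           a :* (d :* D′ :- p :* X₂ :+ p :* X₃) :- b :* (c :* D′ :- p :* X₂ :+ p :* X₃)
             :+ p :* (c :* X₂ :- d :* X₂ :+ p :* Z) :- p :* (c :* X₃ :- d :* X₃ :+ p :* Z)
           := (a :* d :- b :* c) :* D′ :- (p :* (((a :+ d) :- b) :- c)) :* (X₂ :- X₃))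
         refl a b c d p D′ X₂ X₃ Z ⟩
    (a * d - b * c) * D′ - (p * τ A) * (X₂ - X₃)
      ≈⟨ +-cong (*-congʳ (sym (det₂ A))) (-‿cong (*-congˡ X₂-X₃)) ⟩
    det R 2 A * D′ - (p * τ A) * (q * (τ A′ * det R m M))
      ≈⟨ +-congˡ (-‿cong (solve 5 (λ p t q t′ e → (p :* t) :* (q :* (t′ :* e))
                                                  := (((p :* q) :* t) :* t′) :* e)
                                  refl p (τ A) q (τ A′) (det R m M))) ⟩
    det R 2 A * D′ - (((p * q) * τ A) * τ A′) * det R m M ∎
    where
    N = bordered A p q (bordered A′ p′ q′ M)
    a = A (# 0) (# 0)
    b = A (# 0) (# 1)
    c = A (# 1) (# 0)
    d = A (# 1) (# 1)
    D′ = det R (2 ℕ.+ m) (bordered A′ p′ q′ M)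
    -- values of the minors of N on rows ≥ 2 omitting column 0 or 1 together with column 2 (X₂)
    -- or 3 (X₃); Z omits columns 2 and 3 and cancels out
    X₂ = q * ((A′ (# 1) (# 1) - A′ (# 0) (# 1)) * det R m M)
    X₃ = q * ((A′ (# 1) (# 0) - A′ (# 0) (# 0)) * det R m M)
    Z = det R (2 ℕ.+ m) (minor (# 0) (# 2) (minor (# 0) (# 2) N))

    X₂-X₃ : X₂ - X₃ ≈ q * (τ A′ * det R m M)
    X₂-X₃ = solve 6 (λ q a′ b′ c′ d′ e →
        q :* ((d′ :- b′) :* e) :- q :* ((c′ :- a′) :* e) := q :* ((((a′ :+ d′) :- b′) :- c′) :* e))
      refl q (A′ (# 0) (# 0)) (A′ (# 0) (# 1)) (A′ (# 1) (# 0)) (A′ (# 1) (# 1)) (det R m M)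

    minor₀ : det R (3 ℕ.+ m) (minor (# 0) (# 0) N) ≈ d * D′ - p * X₂ + p * X₃
    minor₀ = det-firstRowSupport₃ (minor (# 0) (# 0) N) (λ _ → refl) refl
      (det-doubledFirstColumn (minor (# 0) (# 1) (minor (# 0) (# 0) N)) (λ _ → refl) refl (λ _ → refl))
      (det-doubledFirstColumn (minor (# 0) (# 2) (minor (# 0) (# 0) N)) (λ _ → refl) refl (λ _ → refl))

    minor₁ : det R (3 ℕ.+ m) (minor (# 0) (# 1) N) ≈ c * D′ - p * X₂ + p * X₃
    minor₁ = det-firstRowSupport₃ (minor (# 0) (# 1) N) (λ _ → refl) refl
      (det-doubledFirstColumn (minor (# 0) (# 1) (minor (# 0) (# 1) N)) (λ _ → refl) refl (λ _ → refl))
      (det-doubledFirstColumn (minor (# 0) (# 2) (minor (# 0) (# 1) N)) (λ _ → refl) refl (λ _ → refl))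

    minor₂ : det R (3 ℕ.+ m) (minor (# 0) (# 2) N) ≈ c * X₂ - d * X₂ + p * Z
    minor₂ = det-firstRowSupport₃ (minor (# 0) (# 2) N) (λ _ → refl)
      (det-doubledFirstColumn (minor (# 0) (# 0) (minor (# 0) (# 2) N)) (λ _ → refl) refl (λ _ → refl))
      (det-doubledFirstColumn (minor (# 0) (# 1) (minor (# 0) (# 2) N)) (λ _ → refl) refl (λ _ → refl))
      refl

    without23≈Z : det R (2 ℕ.+ m) (minor (# 0) (# 2) (minor (# 0) (# 3) N)) ≈ Z
    without23≈Z = det-cong (2 ℕ.+ m) {minor (# 0) (# 2) (minor (# 0) (# 3) N)}
                                     {minor (# 0) (# 2) (minor (# 0) (# 2) N)}
      λ { _ zero → refl ; _ (suc zero) → refl ; _ (suc (suc _)) → refl }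

    minor₃ : det R (3 ℕ.+ m) (minor (# 0) (# 3) N) ≈ c * X₃ - d * X₃ + p * Z
    minor₃ = det-firstRowSupport₃ (minor (# 0) (# 3) N) (λ _ → refl)
      (det-doubledFirstColumn (minor (# 0) (# 0) (minor (# 0) (# 3) N)) (λ _ → refl) refl (λ _ → refl))
      (det-doubledFirstColumn (minor (# 0) (# 1) (minor (# 0) (# 3) N)) (λ _ → refl) refl (λ _ → refl))
      without23≈Z

  blockTridiag : (ℕ → Matrix R 2) → (ℕ → Carrier) → (ℕ → Carrier) →
    ∀ k → Matrix R (k ℕ.* 2)
  blockTridiag A p q zero    = λ ()
  blockTridiag A p q (suc k) =
    bordered (A 1) (p 1) (q 1) (blockTridiag (A ∘ ℕ.suc) (p ∘ ℕ.suc) (q ∘ ℕ.suc) k)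

  coupling : (ℕ → Matrix R 2) → (ℕ → Carrier) → (ℕ → Carrier) → ℕ → Carrier
  coupling A p q i = ((p i * q i) * τ (A i)) * τ (A (suc i))

  continuant : (ℕ → Carrier) → (ℕ → Carrier) → ℕ → Carrier
  continuant δ β zero          = 1#
  continuant δ β (suc zero)    = δ 1
  continuant δ β (suc (suc k)) = δ 1 * continuant (δ ∘ ℕ.suc) (β ∘ ℕ.suc) (suc k)
                                 - β 1 * continuant (δ ∘ ℕ.suc ∘ ℕ.suc) (β ∘ ℕ.suc ∘ ℕ.suc) k

  det-blockTridiag : ∀ A p q k →
    det R (k ℕ.* 2) (blockTridiag A p q k) ≈ continuant (λ i → det R 2 (A i)) (coupling A p q) k
  det-blockTridiag A p q zero          = refl
  det-blockTridiag A p q (suc zero)    = refl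
  det-blockTridiag A p q (suc (suc k)) = trans
    (det-bordered₂ (A 1) (A 2) (p 1) (q 1) (p 2) (q 2) (blockTridiag A″ p″ q″ k))
    (+-cong (*-congˡ (det-blockTridiag (A ∘ ℕ.suc) (p ∘ ℕ.suc) (q ∘ ℕ.suc) (suc k)))
            (-‿cong (*-congˡ (det-blockTridiag A″ p″ q″ k))))
    where
    A″ = A ∘ ℕ.suc ∘ ℕ.suc
    p″ = p ∘ ℕ.suc ∘ ℕ.suc
    q″ = q ∘ ℕ.suc ∘ ℕ.suc

  continuant-reverse : ∀ δ β k →
    continuant δ β (suc (suc k))
      ≈ δ (suc (suc k)) * continuant δ β (suc k) - β (suc k) * continuant δ β k
  continuant-reverse δ β zero =
    solve 3 (λ x y z → x :* y :- z :* con (+ 1) := y :* x :- z :* con (+ 1)) refl (δ 1) (δ 2) (β 1)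
  continuant-reverse δ β (suc zero) = begin
    δ 1 * continuant (δ ∘ ℕ.suc) (β ∘ ℕ.suc) 2 - β 1 * δ 3
      ≈⟨ +-congʳ (*-congˡ (continuant-reverse (δ ∘ ℕ.suc) (β ∘ ℕ.suc) zero)) ⟩
    δ 1 * (δ 3 * δ 2 - β 2 * 1#) - β 1 * δ 3
      ≈⟨ solve 5 (λ δ₁ δ₂ δ₃ β₁ β₂ →
           δ₁ :* (δ₃ :* δ₂ :- β₂ :* con (+ 1)) :- β₁ :* δ₃
           := δ₃ :* (δ₁ :* δ₂ :- β₁ :* con (+ 1)) :- β₂ :* δ₁)
         refl (δ 1) (δ 2) (δ 3) (β 1) (β 2) ⟩
    δ 3 * continuant δ β 2 - β 2 * continuant δ β 1 ∎
  continuant-reverse δ β (suc (suc k)) = begin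
    δ 1 * K′ (3 ℕ.+ k) - β 1 * K″ (2 ℕ.+ k)
      ≈⟨ +-cong (*-congˡ (continuant-reverse (δ ∘ ℕ.suc) (β ∘ ℕ.suc) (suc k)))
                (-‿cong (*-congˡ
                  (continuant-reverse (δ ∘ ℕ.suc ∘ ℕ.suc) (β ∘ ℕ.suc ∘ ℕ.suc) k))) ⟩
    δ 1 * (x * K′ (2 ℕ.+ k) - y * K′ (1 ℕ.+ k)) - β 1 * (x * K″ (1 ℕ.+ k) - y * K″ k)
      ≈⟨ solve 8 (λ δ₁ β₁ x y u₂ u₁ v₁ v₀ →
           δ₁ :* (x :* u₂ :- y :* u₁) :- β₁ :* (x :* v₁ :- y :* v₀)
           := x :* (δ₁ :* u₂ :- β₁ :* v₁) :- y :* (δ₁ :* u₁ :- β₁ :* v₀))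
         refl (δ 1) (β 1) x y (K′ (2 ℕ.+ k)) (K′ (1 ℕ.+ k)) (K″ (1 ℕ.+ k)) (K″ k) ⟩
    x * continuant δ β (3 ℕ.+ k) - y * continuant δ β (2 ℕ.+ k) ∎
    where
    K′ = continuant (δ ∘ ℕ.suc) (β ∘ ℕ.suc)
    K″ = continuant (δ ∘ ℕ.suc ∘ ℕ.suc) (β ∘ ℕ.suc ∘ ℕ.suc)
    x = δ (4 ℕ.+ k)
    y = β (3 ℕ.+ k)

  -- Block indices are 0-based and the sequences A, p, q 1-based, as in Tridiag.block. The
  -- (suc I) (suc J) clause precedes (suc zero) zero so that it fires for a variable I.
  tridiagBlock : (ℕ → Matrix R 2) → (ℕ → Carrier) → (ℕ → Carrier) → ℕ → ℕ → Matrix R 2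
  tridiagBlock A p q zero       zero       = A 1
  tridiagBlock A p q zero       (suc zero) = λ _ _ → p 1
  tridiagBlock A p q (suc I)    (suc J)    = tridiagBlock (A ∘ ℕ.suc) (p ∘ ℕ.suc) (q ∘ ℕ.suc) I J
  tridiagBlock A p q (suc zero) zero       = λ _ _ → q 1
  tridiagBlock A p q _          _          = λ _ _ → 0#

  tridiagBlock-diagonal : ∀ A p q I u v → tridiagBlock A p q I I u v ≡ A (suc I) u v
  tridiagBlock-diagonal A p q zero    u v = ≡.refl
  tridiagBlock-diagonal A p q (suc I) u v =
    tridiagBlock-diagonal (A ∘ ℕ.suc) (p ∘ ℕ.suc) (q ∘ ℕ.suc) I u v

  tridiagBlock-super : ∀ A p q I u v → tridiagBlock A p q I (suc I) u v ≡ p (suc I)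
  tridiagBlock-super A p q zero    u v = ≡.refl
  tridiagBlock-super A p q (suc I) u v = tridiagBlock-super (A ∘ ℕ.suc) (p ∘ ℕ.suc) (q ∘ ℕ.suc) I u v

  tridiagBlock-sub : ∀ A p q J u v → tridiagBlock A p q (suc J) J u v ≡ q (suc J)
  tridiagBlock-sub A p q zero    u v = ≡.refl
  tridiagBlock-sub A p q (suc J) u v = tridiagBlock-sub (A ∘ ℕ.suc) (p ∘ ℕ.suc) (q ∘ ℕ.suc) J u v

  tridiagBlock-far : ∀ A p q {I J} → I ≢ J → suc I ≢ J → I ≢ suc J →
    ∀ u v → tridiagBlock A p q I J u v ≡ 0#
  tridiagBlock-far A p q {zero}        {zero}        I≢J _     _     u v = ⊥-elim (I≢J ≡.refl)
  tridiagBlock-far A p q {zero}        {suc zero}    _   I+1≢J _     u v = ⊥-elim (I+1≢J ≡.refl)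
  tridiagBlock-far A p q {zero}        {suc (suc J)} _   _     _     u v = ≡.refl
  tridiagBlock-far A p q {suc zero}    {zero}        _   _     I≢J+1 u v = ⊥-elim (I≢J+1 ≡.refl)
  tridiagBlock-far A p q {suc (suc I)} {zero}        _   _     _     u v = ≡.refl
  tridiagBlock-far A p q {suc I}       {suc J}       I≢J I+1≢J I≢J+1 u v =
    tridiagBlock-far (A ∘ ℕ.suc) (p ∘ ℕ.suc) (q ∘ ℕ.suc)
      (I≢J ∘ ≡.cong suc) (I+1≢J ∘ ≡.cong suc) (I≢J+1 ∘ ≡.cong suc) u v

  blockIndex : ∀ k → Fin (k ℕ.* 2) → ℕ
  blockIndex k r = toℕ (proj₂ (quotRem {k} 2 r))

  blockOffset : ∀ k → Fin (k ℕ.* 2) → Fin 2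
  blockOffset k r = proj₁ (quotRem {k} 2 r)

  headPair-super : ∀ A p q k (s : Fin (k ℕ.* 2)) u v →
    headPair (p 1) s ≡ tridiagBlock A p q 0 (suc (blockIndex k s)) u v
  headPair-super A p q (suc k) zero          u v = ≡.refl
  headPair-super A p q (suc k) (suc zero)    u v = ≡.refl
  headPair-super A p q (suc k) (suc (suc s)) u v = ≡.refl

  headPair-sub : ∀ A p q k (r : Fin (k ℕ.* 2)) u v →
    headPair (q 1) r ≡ tridiagBlock A p q (suc (blockIndex k r)) 0 u v
  headPair-sub A p q (suc k) zero          u v = ≡.refl
  headPair-sub A p q (suc k) (suc zero)    u v = ≡.refl
  headPair-sub A p q (suc k) (suc (suc r)) u v = ≡.refl

  blockTridiag-entry : ∀ A p q k r s →
    blockTridiag A p q k r s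
      ≡ tridiagBlock A p q (blockIndex k r) (blockIndex k s) (blockOffset k r) (blockOffset k s)
  blockTridiag-entry A p q (suc k) zero          zero          = ≡.refl
  blockTridiag-entry A p q (suc k) zero          (suc zero)    = ≡.refl
  blockTridiag-entry A p q (suc k) (suc zero)    zero          = ≡.refl
  blockTridiag-entry A p q (suc k) (suc zero)    (suc zero)    = ≡.refl
  blockTridiag-entry A p q (suc k) zero          (suc (suc s)) = headPair-super A p q k s zero _
  blockTridiag-entry A p q (suc k) (suc zero)    (suc (suc s)) = headPair-super A p q k s (suc zero) _
  blockTridiag-entry A p q (suc k) (suc (suc r)) zero          = headPair-sub A p q k r _ zero
  blockTridiag-entry A p q (suc k) (suc (suc r)) (suc zero)    = headPair-sub A p q k r _ (suc zero)
  blockTridiag-entry A p q (suc k) (suc (suc r)) (suc (suc s)) =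
    blockTridiag-entry (A ∘ ℕ.suc) (p ∘ ℕ.suc) (q ∘ ℕ.suc) k r s

module TridiagAsBlockTridiag {ℓ₁ ℓ₂ : Level} (R : CommutativeRing ℓ₁ ℓ₂)
                             (a b c d p q : ℕ → CommutativeRing.Carrier R) where
  open CommutativeRing R using (_≈_; reflexive; trans)
  open Tridiag R a b c d p q
  open Determinant R using (det-cong)
  open BlockTridiagonal R

  block≡tridiagBlock : ∀ I J u v → block I J u v ≡ tridiagBlock A p q I J u v
  block≡tridiagBlock I J u v with I ℕ.≟ J | suc I ℕ.≟ J | I ℕ.≟ suc J
  ... | yes ≡.refl | _          | _          = ≡.sym (tridiagBlock-diagonal A p q I u v)
  ... | no _       | yes ≡.refl | _          = ≡.sym (tridiagBlock-super A p q I u v)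
  ... | no _       | no _       | yes ≡.refl = ≡.sym (tridiagBlock-sub A p q J u v)
  ... | no I≢J     | no I+1≢J   | no I≢J+1   = ≡.sym (tridiagBlock-far A p q I≢J I+1≢J I≢J+1 u v)

  g≈det-blockTridiag : ∀ k → g k ≈ det R (k ℕ.* 2) (blockTridiag A p q k)
  g≈det-blockTridiag k = det-cong (k ℕ.* 2) λ r s → reflexive (≡.trans
    (block≡tridiagBlock (blockIndex k r) (blockIndex k s) (blockOffset k r) (blockOffset k s))
    (≡.sym (blockTridiag-entry A p q k r s)))

  g≈continuant : ∀ k → g k ≈ continuant (λ i → det R 2 (A i)) (coupling A p q) k
  g≈continuant k = trans (g≈det-blockTridiag k) (det-blockTridiag A p q k)

theorem2p3 : ∀ {ℓ₁ ℓ₂ : Level} (R : CommutativeRing ℓ₁ ℓ₂)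
    (a b c d p q : ℕ → CommutativeRing.Carrier R) (n : ℕ) → 1 ≤ n →
    (∀ i → 1 ≤ i → i ≤ n → IsUnit R (det R 2 (Tridiag.A R a b c d p q i))) →
    let open CommutativeRing R
        open Tridiag R a b c d p q
        detA = λ i → det R 2 (A i)
    in (g 1 ≈ a 1 * d 1 + - (b 1 * c 1))
       × (2 ≤ n → g 2 ≈ detA 1 * detA 2 + - (((p 1 * q 1) * t 1) * t 2))
       × (3 ≤ n → g n ≈ detA n * g (n Data.Nat.∸ 1)
                         + - ((((p (n Data.Nat.∸ 1) * q (n Data.Nat.∸ 1)) * t n) * t (n Data.Nat.∸ 1)) * g (n Data.Nat.∸ 2)))
theorem2p3 R a b c d p q n _ _ = g₁ , (λ _ → g₂) , gₙ n
  where
  open CommutativeRing R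
  open Tridiag R a b c d p q
  open Determinant R using (det₂)
  open BlockTridiagonal R using (continuant; coupling; continuant-reverse)
  open TridiagAsBlockTridiag R a b c d p q using (g≈continuant)
  open import Algebra.Properties.CommutativeSemigroup *-commutativeSemigroup using (xy∙z≈xz∙y)
  open import Relation.Binary.Reasoning.Setoid setoid

  K : ℕ → Carrier
  K = continuant (λ i → det R 2 (A i)) (coupling A p q)

  g₁ : g 1 ≈ a 1 * d 1 - b 1 * c 1
  g₁ = trans (g≈continuant 1) (det₂ (A 1))

  g₂ : g 2 ≈ det R 2 (A 1) * det R 2 (A 2) - ((p 1 * q 1) * t 1) * t 2
  g₂ = trans (g≈continuant 2) (+-congˡ (-‿cong (*-identityʳ _)))

  gₙ : ∀ n → 3 ≤ n → g n ≈ det R 2 (A n) * g (n ℕ.∸ 1)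
                           - (((p (n ℕ.∸ 1) * q (n ℕ.∸ 1)) * t n) * t (n ℕ.∸ 1)) * g (n ℕ.∸ 2)
  gₙ (suc (suc (suc m))) (s≤s (s≤s (s≤s _))) = begin
    g (3 ℕ.+ m)                                                   ≈⟨ g≈continuant (3 ℕ.+ m) ⟩
    K (3 ℕ.+ m)                                                   ≈⟨ continuant-reverse _ _ (suc m) ⟩
    det R 2 (A (3 ℕ.+ m)) * K (2 ℕ.+ m) - coupling A p q (2 ℕ.+ m) * K (suc m)
      ≈⟨ +-cong (*-congˡ (sym (g≈continuant (2 ℕ.+ m))))
                (-‿cong (*-cong (xy∙z≈xz∙y _ _ _) (sym (g≈continuant (suc m))))) ⟩
    det R 2 (A (3 ℕ.+ m)) * g (2 ℕ.+ m)
      - (((p (2 ℕ.+ m) * q (2 ℕ.+ m)) * t (3 ℕ.+ m)) * t (2 ℕ.+ m)) * g (suc m) ∎
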